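{- Let $G$ be a graph with no isolated vertices and with exactly $f$ full vertices. Then $c(G)\ge d(G)-f$.
   Context: All graphs are finite and simple; $n$ denotes the order of $G$. A full vertex is a vertex of degree $n-1$. A set $S\subseteq V(G)$ is a dominating set if every vertex of $V(G)\setminus S$ is adjacent to a vertex of $S$. The domatic number $d(G)$ is the maximum $k$ such that $V(G)$ can be partitioned into $k$ dominating sets. A coalition consists of two disjoint vertex sets $V_1,V_2$, neither of which is dominating, with $V_1\cup V_2$ dominating. A $c$-partition of $G$ is a partition $\pi=\{V_1,\dots,V_k\}$ of $V(G)$ such that every $V_i$ is either a singleton dominating set, or is not dominating but forms a coalition with some other set $V_j\in\pi$. The coalition count $c(G)$ is the maximum, over all $c$-partitions $\pi$ of $G$, of the number of unordered pairs $\{V_i,V_j\}$ of distinct sets of $\pi$ that form a coalition. -}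

module Defs where

open import Data.Nat using (ℕ; zero; suc; _+_; _≤_)
open import Data.Fin using (Fin; zero; suc; _<_)
open import Data.Fin.Properties using (any?; all?; _≟_; _<?_)
open import Data.Product using (Σ; ∃; _×_; _,_)
open import Data.Sum using (_⊎_)
open import Relation.Nullary using (¬_; Dec; yes; no)
open import Relation.Nullary.Decidable using (_×-dec_; _⊎-dec_; ¬?)
open import Relation.Binary.PropositionalEquality using (_≡_; _≢_)

record Graph (n : ℕ) : Set₁ where
  field
    Adj   : Fin n → Fin n → Set
    adj?  : (u v : Fin n) → Dec (Adj u v)
    sym   : ∀ {u v} → Adj u v → Adj v u
    irrefl : ∀ {v} → ¬ Adj v v

open Graph public

countFin : ∀ {n} {P : Fin n → Set} → ((i : Fin n) → Dec (P i)) → ℕ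
countFin {zero} P? = 0
countFin {suc n} P? with P? zero
... | yes _ = suc (countFin (λ i → P? (suc i)))
... | no  _ = countFin (λ i → P? (suc i))

sumFin : ∀ {n} → (Fin n → ℕ) → ℕ
sumFin {zero} f = 0
sumFin {suc n} f = f zero + sumFin (λ i → f (suc i))

module _ {n : ℕ} (G : Graph n) where

  Dominating : (Fin n → Set) → Set
  Dominating S = ∀ v → S v ⊎ ∃ λ u → S u × Adj G u v

  dominating? : {S : Fin n → Set} → ((v : Fin n) → Dec (S v)) → Dec (Dominating S)
  dominating? S? = all? λ v → S? v ⊎-dec any? (λ u → S? u ×-dec adj? G u v)

  IsFull : Fin n → Set
  IsFull v = ∀ u → u ≢ v → Adj G u v

  isFull? : (v : Fin n) → Dec (IsFull v)
  isFull? v = all? λ u → (¬? (u ≟ v)) →-dec adj? G u v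
    where
    _→-dec_ : ∀ {A B : Set} → Dec A → Dec B → Dec (A → B)
    yes a →-dec yes b = yes (λ _ → b)
    yes a →-dec no ¬b = no (λ f → ¬b (f a))
    no ¬a →-dec _     = yes (λ a → Data.Empty.⊥-elim (¬a a))
      where import Data.Empty

  numFull : ℕ
  numFull = countFin isFull?

  NoIsolated : Set
  NoIsolated = ∀ v → ∃ λ u → Adj G u v

  -- a partition of V(G) into k (nonempty) classes, given by a surjective labelling
  Surj : ∀ {k} → (Fin n → Fin k) → Set
  Surj p = ∀ i → ∃ λ v → p v ≡ i

  Class : ∀ {k} → (Fin n → Fin k) → Fin k → Fin n → Set
  Class p i v = p v ≡ i

  DomaticPartition : ∀ {k} → (Fin n → Fin k) → Set
  DomaticPartition p = Surj p × (∀ i → Dominating (Class p i))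

  IsDomaticNumber : ℕ → Set
  IsDomaticNumber d =
    (Σ (Fin n → Fin d) DomaticPartition) ×
    (∀ k (p : Fin n → Fin k) → DomaticPartition p → k ≤ d)

  Coalition : ∀ {k} → (Fin n → Fin k) → Fin k → Fin k → Set
  Coalition p i j =
    i ≢ j × ¬ Dominating (Class p i) × ¬ Dominating (Class p j) ×
    Dominating (λ v → Class p i v ⊎ Class p j v)

  coalition? : ∀ {k} (p : Fin n → Fin k) (i j : Fin k) → Dec (Coalition p i j)
  coalition? p i j =
    ¬? (i ≟ j) ×-dec ¬? (dominating? (λ v → p v ≟ i)) ×-dec
    ¬? (dominating? (λ v → p v ≟ j)) ×-dec
    dominating? (λ v → (p v ≟ i) ⊎-dec (p v ≟ j))

  Singleton : ∀ {k} → (Fin n → Fin k) → Fin k → Set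
  Singleton p i = ∃ λ v → p v ≡ i × (∀ u → p u ≡ i → u ≡ v)

  IsCPartition : ∀ {k} → (Fin n → Fin k) → Set
  IsCPartition p = Surj p ×
    (∀ i → (Singleton p i × Dominating (Class p i))
         ⊎ (¬ Dominating (Class p i) × ∃ λ j → Coalition p i j))

  -- number of unordered pairs {V_i, V_j} of π forming a coalition (counted as i < j)
  coalitionPairs : ∀ {k} → (Fin n → Fin k) → ℕ
  coalitionPairs {k} p = sumFin λ i → countFin (λ j → (i <? j) ×-dec coalition? p i j)

  IsCoalitionCount : ℕ → Set
  IsCoalitionCount c =
    (∃ λ k → Σ (Fin n → Fin k) λ p → IsCPartition p × coalitionPairs p ≡ c) ×
    (∀ k (p : Fin n → Fin k) → IsCPartition p → coalitionPairs p ≤ c)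

{-# OPTIONS --safe #-}
-- Fix a domatic partition π into d classes; at most f of them contain a full vertex (if all
-- do, d ∸ f = 0). Recolour the vertices of those classes with one full-free class γ₀, so that
-- every colour class is free of full vertices and still dominating. Starting from singletons,
-- repeatedly merge two classes of non-full vertices of one colour whose union does not
-- dominate. In the resulting partition every full vertex is a dominating singleton and any
-- two classes of one colour form a coalition; a colour class dominates, so it is split into
-- at least two classes. Each of the at least d ∸ f full-free colours thus yields a coalition
-- pair, and different colours yield different pairs.
module Submission where

open import Defs hiding (sym)
open import Data.Nat using (ℕ; zero; suc; _+_; _∸_; _≤_; z≤n; s≤s)
open import Data.Nat.Properties
  using (≤-trans; +-suc; +-mono-≤; m≤n⇒m≤o+n; ∸-monoʳ-≤; m+n∸m≡n; module ≤-Reasoning)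
open import Data.Fin using (Fin; zero; suc; punchOut; punchIn) renaming (_<_ to _<ᶠ_)
open import Data.Fin.Properties
  using (any?; _≟_; _<?_; <-cmp; suc-injective; punchOut-injective; punchOut-cong; punchOut-punchIn; punchInᵢ≢i)
open import Data.Product using (∃; ∃₂; Σ; _×_; _,_; proj₁; proj₂)
open import Data.Sum using (_⊎_; inj₁; inj₂)
open import Function using (_∘_; id; case_of_)
open import Relation.Binary using (tri<; tri≈; tri>)
open import Relation.Nullary using (¬_; Dec; yes; no; contradiction)
open import Relation.Nullary.Decidable using (_×-dec_; _⊎-dec_; ¬?; decidable-stable)
open import Relation.Unary using (Decidable; _⊆_; _∪_; Empty; ∁)
open import Relation.Unary.Properties using (∁?)
open import Relation.Binary.PropositionalEquality
  using (_≡_; _≢_; refl; sym; trans; cong; subst; module ≡-Reasoning)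

private
  variable
    a b : ℕ

countFin-yes : {P : Fin (suc a) → Set} (P? : Decidable P) → P zero →
               countFin P? ≡ suc (countFin (P? ∘ suc))
countFin-yes P? p with P? zero
... | yes _ = refl
... | no ¬p = contradiction p ¬p

countFin-no : {P : Fin (suc a) → Set} (P? : Decidable P) → ¬ P zero →
              countFin P? ≡ countFin (P? ∘ suc)
countFin-no P? ¬p with P? zero
... | yes p = contradiction p ¬p
... | no _ = refl

countFin-cong : {P : Fin a → Set} {Q : Fin a → Set} (P? : Decidable P) (Q? : Decidable Q) →
                P ⊆ Q → Q ⊆ P → countFin P? ≡ countFin Q?
countFin-cong {zero} P? Q? P⊆Q Q⊆P = refl
countFin-cong {suc a} P? Q? P⊆Q Q⊆P with P? zero | Q? zero
... | yes _ | yes _ = cong suc (countFin-cong (P? ∘ suc) (Q? ∘ suc) P⊆Q Q⊆P)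
... | yes p | no ¬q = contradiction (P⊆Q p) ¬q
... | no ¬p | yes q = contradiction (Q⊆P q) ¬p
... | no _  | no _  = countFin-cong (P? ∘ suc) (Q? ∘ suc) P⊆Q Q⊆P

countFin-empty : {P : Fin a → Set} (P? : Decidable P) → Empty P → countFin P? ≡ 0
countFin-empty {zero} P? empty = refl
countFin-empty {suc a} P? empty with P? zero
... | yes p = contradiction p (empty zero)
... | no _ = countFin-empty (P? ∘ suc) (empty ∘ suc)

countFin-positive : {P : Fin a → Set} (P? : Decidable P) {x : Fin a} → P x → 1 ≤ countFin P?
countFin-positive P? {zero} p with P? zero
... | yes _ = s≤s z≤n
... | no ¬p = contradiction p ¬p
countFin-positive P? {suc x} p with P? zero
... | yes _ = s≤s z≤n
... | no _ = countFin-positive (P? ∘ suc) p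

countFin-∁ : {P : Fin a → Set} (P? : Decidable P) → countFin P? + countFin (∁? P?) ≡ a
countFin-∁ {zero} P? = refl
countFin-∁ {suc a} P? with P? zero
... | yes _ = cong suc (countFin-∁ (P? ∘ suc))
... | no _ = trans (+-suc _ _) (cong suc (countFin-∁ (P? ∘ suc)))

countFin-≢-suc : {Q : Fin (suc b) → Set} (Q? : Decidable Q) (y : Fin b) →
                 countFin (λ z → Q? (suc z) ×-dec ¬? (z ≟ y)) ≡
                 countFin (λ z → Q? (suc z) ×-dec ¬? (suc z ≟ suc y))
countFin-≢-suc Q? y =
  countFin-cong (λ z → Q? (suc z) ×-dec ¬? (z ≟ y)) (λ z → Q? (suc z) ×-dec ¬? (suc z ≟ suc y))
    (λ (q , z≢y) → q , z≢y ∘ suc-injective) (λ (q , z≢y) → q , z≢y ∘ cong suc)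

countFin-remove : {Q : Fin b → Set} (Q? : Decidable Q) {y : Fin b} → Q y →
                  countFin Q? ≡ suc (countFin (λ z → Q? z ×-dec ¬? (z ≟ y)))
countFin-remove Q? {zero} q₀ = begin
  countFin Q?
    ≡⟨ countFin-yes Q? q₀ ⟩
  suc (countFin (Q? ∘ suc))
    ≡⟨ cong suc (countFin-cong (Q? ∘ suc) (λ z → Q? (suc z) ×-dec ¬? (suc z ≟ zero))
                               (λ q → q , λ ()) proj₁) ⟩
  suc (countFin (λ z → Q? (suc z) ×-dec ¬? (suc z ≟ zero)))
    ≡⟨ cong suc (countFin-no (λ z → Q? z ×-dec ¬? (z ≟ zero)) (λ (_ , 0≢0) → 0≢0 refl)) ⟨
  suc (countFin (λ z → Q? z ×-dec ¬? (z ≟ zero)))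
    ∎
  where open ≡-Reasoning
countFin-remove Q? {suc y} qy with Q? zero
... | yes _ = cong suc (trans (countFin-remove (Q? ∘ suc) qy) (cong suc (countFin-≢-suc Q? y)))
... | no _ = trans (countFin-remove (Q? ∘ suc) qy) (cong suc (countFin-≢-suc Q? y))

countFin-≤-injection : {P : Fin a → Set} {Q : Fin b → Set} (P? : Decidable P) (Q? : Decidable Q)
                       (R : Fin a → Fin b → Set) →
                       (∀ {x} → P x → ∃ λ y → Q y × R x y) →
                       (∀ {x x′ y} → R x y → R x′ y → x ≡ x′) →
                       countFin P? ≤ countFin Q?
countFin-≤-injection {zero} P? Q? R image injective = z≤n
countFin-≤-injection {suc a} {P = P} {Q} P? Q? R image injective with P? zero
... | no _ =
  countFin-≤-injection (P? ∘ suc) Q? (R ∘ suc) image (λ r r′ → suc-injective (injective r r′))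
... | yes p₀ with image p₀
...   | y₀ , q₀ , r₀ = begin
  suc (countFin (P? ∘ suc)) ≤⟨ s≤s (countFin-≤-injection (P? ∘ suc) Q?₀ (R ∘ suc) image₀ injective₀) ⟩
  suc (countFin Q?₀)        ≡⟨ countFin-remove Q? q₀ ⟨
  countFin Q?               ∎
  where
  open ≤-Reasoning
  Q?₀ : Decidable (λ y → Q y × y ≢ y₀)
  Q?₀ y = Q? y ×-dec ¬? (y ≟ y₀)
  image₀ : ∀ {x} → P (suc x) → ∃ λ y → (Q y × y ≢ y₀) × R (suc x) y
  image₀ p with image p
  ... | y , q , r = y , (q , λ { refl → case injective r r₀ of λ () }) , r
  injective₀ : ∀ {x x′ y} → R (suc x) y → R (suc x′) y → x ≡ x′
  injective₀ r r′ = suc-injective (injective r r′)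

countFin≤sumFin : {P : Fin a → Set} (P? : Decidable P) (f : Fin a → ℕ) →
                  (∀ {x} → P x → 1 ≤ f x) → countFin P? ≤ sumFin f
countFin≤sumFin {zero} P? f positive = z≤n
countFin≤sumFin {suc a} P? f positive with P? zero
... | yes p = +-mono-≤ (positive p) (countFin≤sumFin (P? ∘ suc) (f ∘ suc) positive)
... | no _ = m≤n⇒m≤o+n (f zero) (countFin≤sumFin (P? ∘ suc) (f ∘ suc) positive)

countFin-≤-byWitness : {P : Fin a → Set} (P? : Decidable P) {m : ℕ} →
                       (∃ P → countFin P? ≤ m) → countFin P? ≤ m
countFin-≤-byWitness P? bound with any? P?
... | yes witness = bound witness
... | no none rewrite countFin-empty P? (λ x p → none (x , p)) = z≤n

module _ {n} (G : Graph n) where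

  dominating-mono : {S T : Fin n → Set} → S ⊆ T → Dominating G S → Dominating G T
  dominating-mono S⊆T dom v with dom v
  ... | inj₁ s = inj₁ (S⊆T s)
  ... | inj₂ (u , s , u~v) = inj₂ (u , S⊆T s , u~v)

  full⇒dominating-singleton : ∀ {v} → IsFull G v → Dominating G (_≡ v)
  full⇒dominating-singleton {v} full u with u ≟ v
  ... | yes u≡v = inj₁ u≡v
  ... | no u≢v = inj₂ (v , refl , Graph.sym G (full u u≢v))

  dominating-singleton⇒full : ∀ {v} → Dominating G (_≡ v) → IsFull G v
  dominating-singleton⇒full dom u u≢v with dom u
  ... | inj₁ u≡v = contradiction u≡v u≢v
  ... | inj₂ (_ , refl , v~u) = Graph.sym G v~u

  LowerCoalition : ∀ {k} → (Fin n → Fin k) → Fin k → Set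
  LowerCoalition p i = ∃ λ j → i <ᶠ j × Coalition G p i j

  lowerCoalition? : ∀ {k} (p : Fin n → Fin k) → Decidable (LowerCoalition p)
  lowerCoalition? p i = any? λ j → (i <? j) ×-dec coalition? G p i j

  lowerCoalitions≤coalitionPairs : ∀ {k} (p : Fin n → Fin k) →
                                   countFin (lowerCoalition? p) ≤ coalitionPairs G p
  lowerCoalitions≤coalitionPairs p =
    countFin≤sumFin (lowerCoalition? p) _ λ {i} (j , i<j , coal) →
      countFin-positive (λ j → (i <? j) ×-dec coalition? G p i j) (i<j , coal)

module _ {k} {i j : Fin (suc k)} (i≢j : i ≢ j) where

  Fused : Fin (suc k) → Set
  Fused x = x ≡ i ⊎ x ≡ j

  redirect : Fin (suc k) → Fin (suc k)
  redirect x with x ≟ j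
  ... | yes _ = i
  ... | no _ = x

  j≢redirect : ∀ x → j ≢ redirect x
  j≢redirect x with x ≟ j
  ... | yes _ = i≢j ∘ sym
  ... | no x≢j = x≢j ∘ sym

  fuse : Fin (suc k) → Fin k
  fuse x = punchOut (j≢redirect x)

  redirect-collapses : ∀ {x y} → redirect x ≡ redirect y → x ≡ y ⊎ (Fused x × Fused y)
  redirect-collapses {x} {y} eq with x ≟ j | y ≟ j
  ... | yes x≡j | yes y≡j = inj₁ (trans x≡j (sym y≡j))
  ... | yes x≡j | no _    = inj₂ (inj₂ x≡j , inj₁ (sym eq))
  ... | no _    | yes y≡j = inj₂ (inj₁ eq , inj₂ y≡j)
  ... | no _    | no _    = inj₁ eq

  fuse-collapses : ∀ {x y} → fuse x ≡ fuse y → x ≡ y ⊎ (Fused x × Fused y)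
  fuse-collapses {x} {y} = redirect-collapses ∘ punchOut-injective (j≢redirect x) (j≢redirect y)

  fuse-punchIn : ∀ y → fuse (punchIn j y) ≡ y
  fuse-punchIn y with punchIn j y ≟ j
  ... | yes eq = contradiction eq (punchInᵢ≢i j y)
  ... | no _ = trans (punchOut-cong j refl) (punchOut-punchIn j)

module Merging {n} (G : Graph n) {d} (colour : Fin n → Fin d) where

  record Admissible {k} (q : Fin n → Fin k) : Set where
    field
      surjective    : Surj G q
      full-alone    : ∀ {u v} → IsFull G u → q v ≡ q u → v ≡ u
      monochromatic : ∀ {u v} → ¬ IsFull G u → q u ≡ q v → colour u ≡ colour v
      nonDominating : ∀ {v} → ¬ IsFull G v → ¬ Dominating G (Class G q (q v))

  Mergeable : ∀ {k} → (Fin n → Fin k) → Set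
  Mergeable q = ∃₂ λ u v → ¬ IsFull G u × ¬ IsFull G v × colour u ≡ colour v × q u ≢ q v ×
                ¬ Dominating G (Class G q (q u) ∪ Class G q (q v))

  mergeable? : ∀ {k} (q : Fin n → Fin k) → Dec (Mergeable q)
  mergeable? q = any? λ u → any? λ v → ¬? (isFull? G u) ×-dec ¬? (isFull? G v) ×-dec
    (colour u ≟ colour v) ×-dec ¬? (q u ≟ q v) ×-dec
    ¬? (dominating? G (λ w → (q w ≟ q u) ⊎-dec (q w ≟ q v)))

  singletons-admissible : Admissible id
  singletons-admissible = record
    { surjective    = λ v → v , refl
    ; full-alone    = λ _ v≡u → v≡u
    ; monochromatic = λ _ → cong colour
    ; nonDominating = λ ¬full → ¬full ∘ dominating-singleton⇒full G
    }

  merge : ∀ {k} {q : Fin n → Fin (suc k)} → Admissible q → Mergeable q →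
          Σ (Fin n → Fin k) Admissible
  merge {q = q} adm (u , v , ¬full-u , ¬full-v , u∼v , qu≢qv , ¬dom) = q′ , record
    { surjective    = surjective′
    ; full-alone    = full-alone′
    ; monochromatic = monochromatic′
    ; nonDominating = nonDominating′
    }
    where
    open Admissible adm
    q′ : Fin n → Fin _
    q′ = fuse qu≢qv ∘ q

    fused-colour : ∀ {a} → Fused qu≢qv (q a) → colour u ≡ colour a
    fused-colour (inj₁ qa≡qu) = monochromatic ¬full-u (sym qa≡qu)
    fused-colour (inj₂ qa≡qv) = trans u∼v (monochromatic ¬full-v (sym qa≡qv))

    full-unfused : ∀ {a} → IsFull G a → ¬ Fused qu≢qv (q a)
    full-unfused full (inj₁ qa≡qu) = ¬full-u (subst (IsFull G) (sym (full-alone full (sym qa≡qu))) full)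
    full-unfused full (inj₂ qa≡qv) = ¬full-v (subst (IsFull G) (sym (full-alone full (sym qa≡qv))) full)

    surjective′ : Surj G q′
    surjective′ y with surjective (punchIn (q v) y)
    ... | w , qw≡ = w , trans (cong (fuse qu≢qv) qw≡) (fuse-punchIn qu≢qv y)

    full-alone′ : ∀ {a b} → IsFull G a → q′ b ≡ q′ a → b ≡ a
    full-alone′ full eq with fuse-collapses qu≢qv eq
    ... | inj₁ qb≡qa = full-alone full qb≡qa
    ... | inj₂ (_ , fused) = contradiction fused (full-unfused full)

    monochromatic′ : ∀ {a b} → ¬ IsFull G a → q′ a ≡ q′ b → colour a ≡ colour b
    monochromatic′ ¬full eq with fuse-collapses qu≢qv eq
    ... | inj₁ qa≡qb = monochromatic ¬full qa≡qb
    ... | inj₂ (fused-a , fused-b) = trans (sym (fused-colour fused-a)) (fused-colour fused-b)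

    nonDominating′ : ∀ {a} → ¬ IsFull G a → ¬ Dominating G (Class G q′ (q′ a))
    nonDominating′ {a} ¬full dom with (q a ≟ q u) ⊎-dec (q a ≟ q v)
    ... | yes fused-a = ¬dom (dominating-mono G class⊆fused dom)
      where
      class⊆fused : Class G q′ (q′ a) ⊆ Fused qu≢qv ∘ q
      class⊆fused eq with fuse-collapses qu≢qv eq
      ... | inj₁ qw≡qa = subst (Fused qu≢qv) (sym qw≡qa) fused-a
      ... | inj₂ (fused-w , _) = fused-w
    ... | no unfused-a = nonDominating ¬full (dominating-mono G class⊆class dom)
      where
      class⊆class : Class G q′ (q′ a) ⊆ Class G q (q a)
      class⊆class eq with fuse-collapses qu≢qv eq
      ... | inj₁ qw≡qa = qw≡qa
      ... | inj₂ (_ , fused-a) = contradiction fused-a unfused-a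

  stabilise : ∀ {k} (q : Fin n → Fin k) → Admissible q →
              ∃ λ k′ → Σ (Fin n → Fin k′) λ q′ → Admissible q′ × ¬ Mergeable q′
  stabilise q adm with mergeable? q
  ... | no stuck = _ , q , adm , stuck
  stabilise {zero} q adm | yes (u , _) with q u
  ... | ()
  stabilise {suc k} q adm | yes mergeable with merge adm mergeable
  ... | q′ , adm′ = stabilise q′ adm′

  ColourClass : Fin d → Fin n → Set
  ColourClass γ x = ¬ IsFull G x × colour x ≡ γ

  colourClass? : ∀ γ → Decidable (ColourClass γ)
  colourClass? γ x = ¬? (isFull? G x) ×-dec (colour x ≟ γ)

  module Stable {k} {q : Fin n → Fin k} (adm : Admissible q) (stuck : ¬ Mergeable q)
                (colourClass-dominating : ∀ v → Dominating G (ColourClass (colour v))) where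

    open Admissible adm

    coalition : ∀ {u w} → ¬ IsFull G u → ¬ IsFull G w → colour u ≡ colour w → q u ≢ q w →
                Coalition G q (q u) (q w)
    coalition {u} {w} ¬full-u ¬full-w u∼w qu≢qw =
      qu≢qw , nonDominating ¬full-u , nonDominating ¬full-w ,
      decidable-stable (dominating? G (λ x → (q x ≟ q u) ⊎-dec (q x ≟ q w)))
        (λ ¬dom → stuck (u , w , ¬full-u , ¬full-w , u∼w , qu≢qw , ¬dom))

    partner : ∀ {w} → ¬ IsFull G w → ∃ λ u → ColourClass (colour w) u × q u ≢ q w
    partner {w} ¬full with any? (λ u → colourClass? (colour w) u ×-dec ¬? (q u ≟ q w))
    ... | yes found = found
    ... | no none =
      contradiction (dominating-mono G colourClass⊆class (colourClass-dominating w)) (nonDominating ¬full)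
      where
      colourClass⊆class : ColourClass (colour w) ⊆ Class G q (q w)
      colourClass⊆class {x} inColour =
        decidable-stable (q x ≟ q w) (λ qx≢qw → none (x , inColour , qx≢qw))

    cPartition : IsCPartition G q
    cPartition = surjective , kind
      where
      kind : ∀ i → (Singleton G q i × Dominating G (Class G q i))
                 ⊎ (¬ Dominating G (Class G q i) × ∃ λ j → Coalition G q i j)
      kind i with surjective i
      kind .(q w) | w , refl with isFull? G w
      ... | yes full = inj₁ ((w , refl , λ _ → full-alone full) ,
                             dominating-mono G (cong q) (full⇒dominating-singleton G full))
      ... | no ¬full with partner ¬full
      ... | u , (¬full-u , u∼w) , qu≢qw =
        inj₂ (nonDominating ¬full , q u , coalition ¬full ¬full-u (sym u∼w) (qu≢qw ∘ sym))

    ClassOfColour : Fin d → Fin k → Set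
    ClassOfColour γ x = ∃ λ z → ColourClass γ z × q z ≡ x

    lowerCoalition-ofColour : ∀ {w} → ¬ IsFull G w →
                              ∃ λ x → LowerCoalition G q x × ClassOfColour (colour w) x
    lowerCoalition-ofColour {w} ¬full with partner ¬full
    ... | u , (¬full-u , u∼w) , qu≢qw with <-cmp (q w) (q u)
    ...   | tri< qw<qu _ _ =
      q w , (q u , qw<qu , coalition ¬full ¬full-u (sym u∼w) (qu≢qw ∘ sym)) , w , (¬full , refl) , refl
    ...   | tri≈ _ qw≡qu _ = contradiction (sym qw≡qu) qu≢qw
    ...   | tri> _ _ qu<qw =
      q u , (q w , qu<qw , coalition ¬full-u ¬full u∼w qu≢qw) , u , (¬full-u , u∼w) , refl

    colours≤lowerCoalitions : {P : Fin d → Set} (P? : Decidable P) →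
                              (∀ {γ} → P γ → ∃ (ColourClass γ)) →
                              countFin P? ≤ countFin (lowerCoalition? G q)
    colours≤lowerCoalitions {P} P? occurs =
      countFin-≤-injection P? (lowerCoalition? G q) ClassOfColour image injective
      where
      image : ∀ {γ} → P γ → ∃ λ x → LowerCoalition G q x × ClassOfColour γ x
      image p with occurs p
      ... | w , ¬full , refl = lowerCoalition-ofColour ¬full
      injective : ∀ {γ γ′ x} → ClassOfColour γ x → ClassOfColour γ′ x → γ ≡ γ′
      injective (_ , (¬full , refl) , refl) (_ , (_ , refl) , qz′≡qz) =
        monochromatic ¬full (sym qz′≡qz)

module FromDomatic {n} (G : Graph n) {d} (π : Fin n → Fin d) (domatic : DomaticPartition G π) where

  HasFull : Fin d → Set
  HasFull γ = ∃ λ v → IsFull G v × π v ≡ γ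

  hasFull? : Decidable HasFull
  hasFull? γ = any? λ v → isFull? G v ×-dec (π v ≟ γ)

  classesWithFull≤numFull : countFin hasFull? ≤ numFull G
  classesWithFull≤numFull =
    countFin-≤-injection hasFull? (isFull? G) (λ γ v → π v ≡ γ) id
      (λ πv≡γ πv≡γ′ → trans (sym πv≡γ) πv≡γ′)

  d∸numFull≤fullFreeClasses : d ∸ numFull G ≤ countFin (∁? hasFull?)
  d∸numFull≤fullFreeClasses = begin
    d ∸ numFull G
      ≤⟨ ∸-monoʳ-≤ d classesWithFull≤numFull ⟩
    d ∸ countFin hasFull?
      ≡⟨ cong (_∸ countFin hasFull?) (countFin-∁ hasFull?) ⟨
    countFin hasFull? + countFin (∁? hasFull?) ∸ countFin hasFull?
      ≡⟨ m+n∸m≡n (countFin hasFull?) _ ⟩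
    countFin (∁? hasFull?)
      ∎
    where open ≤-Reasoning

  module _ (γ₀ : Fin d) (γ₀-fullFree : ¬ HasFull γ₀) where

    colour : Fin n → Fin d
    colour v with hasFull? (π v)
    ... | yes _ = γ₀
    ... | no _ = π v

    colour-fullFree : ∀ v → ¬ HasFull (colour v)
    colour-fullFree v with hasFull? (π v)
    ... | yes _ = γ₀-fullFree
    ... | no πv-fullFree = πv-fullFree

    colour-unchanged : ∀ {v} → ¬ HasFull (π v) → colour v ≡ π v
    colour-unchanged {v} πv-fullFree with hasFull? (π v)
    ... | yes πv-hasFull = contradiction πv-hasFull πv-fullFree
    ... | no _ = refl

    open Merging G colour

    colourClass-dominating : ∀ v → Dominating G (ColourClass (colour v))
    colourClass-dominating v = dominating-mono G inColour (proj₂ domatic (colour v))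
      where
      inColour : ∀ {x} → π x ≡ colour v → ColourClass (colour v) x
      inColour {x} πx≡ =
        (λ full → colour-fullFree v (x , full , πx≡)) ,
        trans (colour-unchanged (subst (¬_ ∘ HasFull) (sym πx≡) (colour-fullFree v))) πx≡

    coalitionPartition : ∃ λ k → Σ (Fin n → Fin k) λ q →
                         IsCPartition G q × countFin (∁? hasFull?) ≤ coalitionPairs G q
    coalitionPartition with stabilise id singletons-admissible
    ... | k , q , adm , stuck =
      k , q , cPartition ,
      ≤-trans (colours≤lowerCoalitions (∁? hasFull?) occurs) (lowerCoalitions≤coalitionPairs G q)
      where
      open Stable adm stuck colourClass-dominating
      occurs : ∀ {γ} → ¬ HasFull γ → ∃ (ColourClass γ)
      occurs {γ} γ-fullFree with proj₁ domatic γ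
      ... | v , refl = v , (λ full → γ-fullFree (v , full , refl)) , colour-unchanged γ-fullFree

mainTheorem2 : ∀ {n} (G : Graph n) (f d c : ℕ) →
    NoIsolated G → numFull G ≡ f → IsDomaticNumber G d → IsCoalitionCount G c →
    d ∸ f ≤ c
mainTheorem2 G f d c _ refl ((π , domatic) , _) (_ , maximal) = begin
  d ∸ numFull G          ≤⟨ d∸numFull≤fullFreeClasses ⟩
  countFin (∁? hasFull?) ≤⟨ countFin-≤-byWitness (∁? hasFull?) fullFree≤c ⟩
  c                      ∎
  where
  open FromDomatic G π domatic
  open ≤-Reasoning
  fullFree≤c : ∃ (∁ HasFull) → countFin (∁? hasFull?) ≤ c
  fullFree≤c (γ₀ , γ₀-fullFree) with coalitionPartition γ₀ γ₀-fullFree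
  ... | k , q , cPart , bound = ≤-trans bound (maximal k q cPart)
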